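{- Let $G$ be a finite simple undirected graph (no loops, no parallel edges) on the vertex set $A_n=\{0,1,\ldots,n-1\}$. There exists an infinite square-free $G$-word if and only if $G$ has a connected subgraph isomorphic to one of the graphs $C_3,\ C_4,\ C_5,\ P_5,\ K_{1,3}$. Moreover, if $G$ has a subgraph $C_3$ or a subgraph $P_m$ with $m\ge 5$, then $\gamma(G)=3$; and if $G$ is $C_4$ or $K_{1,3}$, then $\gamma(G)=4$.
   Context: A word over $A_k=\{0,\ldots,k-1\}$ is a finite sequence of letters; an infinite word is a sequence $i_1i_2\cdots$ of letters. A finite or infinite word is square-free if it has no factor (contiguous block) of the form $uu$ with $u$ nonempty. A finite or infinite word $w=i_1i_2\cdots$ over $A_n$ is a $G$-word if each consecutive pair $i_ji_{j+1}$ is an edge of $G$ (i.e. $w$ is a walk in $G$). A $k$-colouring of $G$ is a map $\varphi\colon A_n\to A_k$, extended letterwise to words. $\gamma(G)$ is the smallest $k$ (if it exists) such that there is an infinite $G$-word $w$ and a $k$-colouring $\varphi$ with $\varphi(w)$ square-free. $P_m$ is the path on $A_m$ with edges $i(i+1)$, $0\le i\le m-2$; $C_m$ is the cycle on $A_m$ with edges $i(i+1)$ (indices mod $m$); $K_{1,3}$ (the claw) is the graph on $A_4$ with edges $01,02,03$. Subgraphs need not be induced. -}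

module Defs where

open import Data.Nat using (ℕ; zero; suc; _+_; _∸_; _<_; _≤_)
open import Data.Fin using (Fin; toℕ)
open import Data.Bool using (Bool; true; false; T)
open import Data.Product using (Σ; ∃; _×_; _,_)
open import Data.Sum using (_⊎_)
open import Relation.Binary.PropositionalEquality using (_≡_; _≢_)
open import Relation.Nullary using (¬_)
open import Function.Definitions using (Injective)

record SimpleGraph (n : ℕ) : Set where
  field
    edge  : Fin n → Fin n → Bool
    sym   : ∀ i j → edge i j ≡ edge j i
    loopless : ∀ i → edge i i ≡ false

Adj : ∀ {n} → SimpleGraph n → Fin n → Fin n → Set
Adj G i j = T (SimpleGraph.edge G i j)

-- Infinite words over an alphabet A are maps ℕ → A.
-- Square-free: no factor uu with u nonempty, i.e. no position i and
-- length l = suc k with w (i + j) ≡ w (i + l + j) for all j < l.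
SquareFree : {A : Set} → (ℕ → A) → Set
SquareFree w = ∀ i k → ¬ (∀ j → j < suc k → w (i + j) ≡ w (i + suc k + j))

IsWalk : ∀ {n} → (Fin n → Fin n → Set) → (ℕ → Fin n) → Set
IsWalk R w = ∀ j → R (w j) (w (suc j))

P : (m : ℕ) → Fin m → Fin m → Set
P m i j = suc (toℕ i) ≡ toℕ j ⊎ suc (toℕ j) ≡ toℕ i

C : (m : ℕ) → Fin m → Fin m → Set
C m i j = P m i j ⊎ ((toℕ i ≡ m ∸ 1 × toℕ j ≡ 0) ⊎ (toℕ j ≡ m ∸ 1 × toℕ i ≡ 0))

K13 : Fin 4 → Fin 4 → Set
K13 i j = (toℕ i ≡ 0 × toℕ j ≢ 0) ⊎ (toℕ j ≡ 0 × toℕ i ≢ 0)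

-- G has a (not necessarily induced) subgraph isomorphic to H:
-- an injective vertex map sending edges of H to edges of G.
HasSubgraph : ∀ {m n} → (Fin m → Fin m → Set) → SimpleGraph n → Set
HasSubgraph {m} {n} H G =
  Σ (Fin m → Fin n) λ f → Injective _≡_ _≡_ f × (∀ i j → H i j → Adj G (f i) (f j))

Colourable : ∀ {n} → (Fin n → Fin n → Set) → ℕ → Set
Colourable {n} R k =
  Σ (ℕ → Fin n) λ w → IsWalk R w × Σ (Fin n → Fin k) λ φ → SquareFree (λ t → φ (w t))

γ≡ : ∀ {n} → (Fin n → Fin n → Set) → ℕ → Set
γ≡ R k = Colourable R k × (∀ k′ → k′ < k → ¬ Colourable R k′)

-- A square-free walk is determined, up to renaming vertices, by its first-occurrence pattern, and
-- the edges it traverses form a subgraph of G. An exhaustive search over patterns shows that every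
-- square-free pattern of length 17 already traverses C₃, C₄, C₅, P₅ or the claw. Conversely each of
-- these graphs carries a square-free walk: the image of Leech's square-free ternary word under a
-- uniform morphism into C₃, C₄ or the claw, and for P₅ (hence C₅) the image of the fixed point of a
-- 2-uniform morphism. These images are square-free by desubstitution: finitely checkable properties of
-- a uniform morphism h (injectivity, synchronisation, unambiguous cuts, no short squares) turn every
-- square of h(x) into a square of x. Read through the colourings 012 of C₃ and 01201 of P₅ the same
-- words give γ = 3. Two colours never suffice, as every binary word of length 4 has a square, and a
-- search over the 3-coloured walks of C₄ and of the claw shows that three colours do not suffice there.

module Submission where

open import Defs
open import Data.Nat
open import Data.Nat.Properties
open import Data.Nat.DivMod
open import Data.Nat.Divisibility using (n∣m*n)
open import Data.Nat.Induction using (<-rec)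
open import Data.Nat.Tactic.RingSolver using (solve-∀)
open import Data.Fin using (Fin; zero; suc; toℕ; inject≤)
import Data.Fin.Properties as Fin
open import Data.Bool using (Bool; true; false; T; _∧_; _∨_; not; if_then_else_)
open import Data.Bool.Properties using (T-∧; T-∨; T-≡)
open import Data.Unit using (tt)
open import Data.Empty using (⊥-elim)
open import Data.Maybe using (Maybe; just; nothing)
open import Data.Product using (Σ; _×_; _,_; proj₁; proj₂)
open import Data.Sum using (_⊎_; inj₁; inj₂)
open import Data.Vec using (Vec; []; _∷_; map)
open import Data.List using (List; []; _∷_; _++_; length; applyUpTo; upTo; filterᵇ; _∷ʳ_)
open import Data.List.Properties using (length-applyUpTo; applyUpTo-∷ʳ)
open import Relation.Binary.PropositionalEquality
open import Relation.Binary.Definitions using (tri<; tri≈; tri>)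
open import Relation.Nullary using (¬_; Dec; yes; no)
open import Relation.Nullary.Decidable using (isYes; toWitness; fromWitness; _⊎-dec_; _×-dec_; ¬?)
open import Function.Base using (_∘_; _∘′_; id)
open import Function.Bundles using (Equivalence; _⇔_; mk⇔)
open import Function.Definitions using (Injective)

open Equivalence using (to; from)

∧-elimˡ : ∀ {x y} → T (x ∧ y) → T x
∧-elimˡ {x} h = proj₁ (to (T-∧ {x}) h)

∧-elimʳ : ∀ {x y} → T (x ∧ y) → T y
∧-elimʳ {x} h = proj₂ (to (T-∧ {x}) h)

∧-intro : ∀ {x y} → T x → T y → T (x ∧ y)
∧-intro {x} p q = from (T-∧ {x}) (p , q)

∨-elim : ∀ {x y} → T (x ∨ y) → T x ⊎ T y
∨-elim {x} = to (T-∨ {x})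

∨-introˡ : ∀ {x y} → T x → T (x ∨ y)
∨-introˡ {x} p = from (T-∨ {x}) (inj₁ p)

∨-introʳ : ∀ {x y} → T y → T (x ∨ y)
∨-introʳ {x} q = from (T-∨ {x}) (inj₂ q)

not-elim : ∀ {x} → T (not x) → ¬ T x
not-elim {true} ()

modusPonens : ∀ {x y} → T (not x ∨ y) → T x → T y
modusPonens {x} h p with ∨-elim {not x} h
... | inj₁ ¬p = ⊥-elim (not-elim ¬p p)
... | inj₂ q = q

allBelow : ℕ → (ℕ → Bool) → Bool
allBelow zero P = true
allBelow (suc n) P = allBelow n P ∧ P n

allBelow-sound : ∀ n P → T (allBelow n P) → ∀ t → t < n → T (P t)
allBelow-sound (suc n) P h t t<1+n with m≤n⇒m<n∨m≡n (≤-pred t<1+n)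
... | inj₁ t<n = allBelow-sound n P (∧-elimˡ h) t t<n
... | inj₂ refl = ∧-elimʳ {allBelow n P} h

allBelow-complete : ∀ n P → (∀ t → t < n → T (P t)) → T (allBelow n P)
allBelow-complete zero P f = tt
allBelow-complete (suc n) P f =
  ∧-intro (allBelow-complete n P (λ t t<n → f t (m≤n⇒m≤1+n t<n))) (f n ≤-refl)

anyBelow : ℕ → (ℕ → Bool) → Bool
anyBelow zero P = false
anyBelow (suc n) P = anyBelow n P ∨ P n

anyBelow-sound : ∀ n P → T (anyBelow n P) → Σ ℕ λ t → t < n × T (P t)
anyBelow-sound (suc n) P h with ∨-elim {anyBelow n P} h
... | inj₁ p = let (t , t<n , q) = anyBelow-sound n P p in t , m≤n⇒m≤1+n t<n , q
... | inj₂ p = n , ≤-refl , p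

anyBelow-complete : ∀ n P t → t < n → T (P t) → T (anyBelow n P)
anyBelow-complete (suc n) P t t<1+n p with m≤n⇒m<n∨m≡n (≤-pred t<1+n)
... | inj₁ t<n = ∨-introˡ (anyBelow-complete n P t t<n p)
... | inj₂ refl = ∨-introʳ {anyBelow n P} p

allFin : ∀ {n} → (Fin n → Bool) → Bool
allFin {zero} P = true
allFin {suc n} P = P zero ∧ allFin (λ i → P (suc i))

allFin-sound : ∀ {n} (P : Fin n → Bool) → T (allFin P) → ∀ i → T (P i)
allFin-sound {suc n} P h zero = ∧-elimˡ h
allFin-sound {suc n} P h (suc i) = allFin-sound (λ j → P (suc j)) (∧-elimʳ {P zero} h) i

allVec : ∀ {a} n → (Vec (Fin a) n → Bool) → Bool
allVec zero P = P []
allVec (suc n) P = allFin (λ x → allVec n (λ v → P (x ∷ v)))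

allVec-sound : ∀ {a} n (P : Vec (Fin a) n → Bool) → T (allVec n P) → ∀ v → T (P v)
allVec-sound zero P h [] = h
allVec-sound (suc n) P h (x ∷ v) = allVec-sound n (λ w → P (x ∷ w)) (allFin-sound _ h x) v

_==_ : ∀ {n} → Fin n → Fin n → Bool
a == b = toℕ a ≡ᵇ toℕ b

==-sound : ∀ {n} {a b : Fin n} → T (a == b) → a ≡ b
==-sound {a = a} {b} h = Fin.toℕ-injective (≡ᵇ⇒≡ (toℕ a) (toℕ b) h)

==-complete : ∀ {n} {a b : Fin n} → a ≡ b → T (a == b)
==-complete {a = a} refl = ≡⇒≡ᵇ (toℕ a) (toℕ a) refl

agreeOn : ∀ {n} → ℕ → (ℕ → Fin n) → (ℕ → Fin n) → Bool
agreeOn len f g = allBelow len (λ t → f t == g t)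

agreeOn-sound : ∀ {n} len (f g : ℕ → Fin n) → T (agreeOn len f g) → ∀ t → t < len → f t ≡ g t
agreeOn-sound len f g h t t<len = ==-sound (allBelow-sound len _ h t t<len)

agreeOn-complete : ∀ {n} len (f g : ℕ → Fin n) → (∀ t → t < len → f t ≡ g t) → T (agreeOn len f g)
agreeOn-complete len f g e = allBelow-complete len _ (λ t t<len → ==-complete (e t t<len))

-- Words and squares

-- Finite words are vectors, read as infinite words by padding with a default letter.
lookupVec : ∀ {A : Set} {n} → A → Vec A n → ℕ → A
lookupVec d [] t = d
lookupVec d (x ∷ v) zero = x
lookupVec d (x ∷ v) (suc t) = lookupVec d v t

lookupVec-map : ∀ {A B : Set} {n} (f : A → B) (d : A) (v : Vec A n) t → lookupVec (f d) (map f v) t ≡ f (lookupVec d v t)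
lookupVec-map f d [] t = refl
lookupVec-map f d (x ∷ v) zero = refl
lookupVec-map f d (x ∷ v) (suc t) = lookupVec-map f d v t

window : ∀ {A : Set} → (ℕ → A) → ℕ → (n : ℕ) → Vec A n
window x q zero = []
window x q (suc n) = x q ∷ window x (suc q) n

lookupVec-window : ∀ {A : Set} (d : A) x q n t → t < n → lookupVec d (window x q n) t ≡ x (q + t)
lookupVec-window d x q (suc n) zero _ = cong x (sym (+-identityʳ q))
lookupVec-window d x q (suc n) (suc t) t<n =
  trans (lookupVec-window d x (suc q) n t (≤-pred t<n)) (cong x (sym (+-suc q t)))

-- A square of period k + 1 at position i; SquareFree w unfolds to ∀ i k → ¬ Square w i k.
Square : {A : Set} → (ℕ → A) → ℕ → ℕ → Set
Square w i k = ∀ j → j < suc k → w (i + j) ≡ w (i + suc k + j)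

squareFree-map⁻ : ∀ {A B : Set} (f : A → B) {w : ℕ → A} → SquareFree (λ t → f (w t)) → SquareFree w
squareFree-map⁻ f squareFree i k sq = squareFree i k λ j j<p → cong f (sq j j<p)

squareFree-map⁺ : ∀ {A B : Set} {f : A → B} → Injective _≡_ _≡_ f →
  ∀ {w} → SquareFree w → SquareFree (λ t → f (w t))
squareFree-map⁺ injective squareFree i k sq = squareFree i k λ j j<p → injective (sq j j<p)

square-in-window : ∀ {A : Set} (d : A) x q n i k → i + suc k + suc k ≤ n →
  Square (lookupVec d (window x q n)) i k → Square x (q + i) k
square-in-window d x q n i k fits sq j j<p = begin
  x (q + i + j)              ≡⟨ cong x (+-assoc q i j) ⟩
  x (q + (i + j))            ≡⟨ lookupVec-window d x q n (i + j) first ⟨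
  lookupVec d (window x q n) (i + j)          ≡⟨ sq j j<p ⟩
  lookupVec d (window x q n) (i + suc k + j)  ≡⟨ lookupVec-window d x q n (i + suc k + j) second ⟩
  x (q + (i + suc k + j))    ≡⟨ cong x (regroup q i (suc k) j) ⟩
  x (q + i + suc k + j)      ∎
  where
  open ≡-Reasoning
  second : i + suc k + j < n
  second = <-≤-trans (+-monoʳ-< (i + suc k) j<p) fits
  first : i + j < n
  first = ≤-<-trans (+-monoˡ-≤ j (m≤m+n i (suc k))) second
  regroup : ∀ a b c d → a + (b + c + d) ≡ a + b + c + d
  regroup = solve-∀

squareWithin : ∀ {a} → (ℕ → Fin a) → ℕ → Bool
squareWithin u N = anyBelow N λ i → anyBelow N λ k →
  (i + suc k + suc k ≤ᵇ N) ∧ agreeOn (suc k) (λ t → u (i + t)) (λ t → u (i + suc k + t))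

squareWithin-sound : ∀ {a} (u : ℕ → Fin a) N → T (squareWithin u N) →
  Σ ℕ λ i → Σ ℕ λ k → i + suc k + suc k ≤ N × Square u i k
squareWithin-sound u N h =
  let (i , _ , h₁) = anyBelow-sound N _ h
      (k , _ , h₂) = anyBelow-sound N _ h₁
  in i , k , ≤ᵇ⇒≤ _ N (∧-elimˡ h₂) , agreeOn-sound (suc k) _ _ (∧-elimʳ {i + suc k + suc k ≤ᵇ N} h₂)

squareWithin-complete : ∀ {a} (u : ℕ → Fin a) N i k → i + suc k + suc k ≤ N → Square u i k →
  T (squareWithin u N)
squareWithin-complete u N i k fits sq =
  anyBelow-complete N _ i (<-≤-trans (m<m+n i (s≤s z≤n)) (≤-trans (m≤m+n _ (suc k)) fits))
    (anyBelow-complete N _ k (<-≤-trans (m<n+m k (s≤s z≤n)) (≤-trans (m≤n+m _ (i + suc k)) fits))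
      (∧-intro (≤⇒≤ᵇ fits) (agreeOn-complete (suc k) _ _ sq)))

Periodic : {A : Set} → (ℕ → A) → ℕ → ℕ → Set
Periodic y i p = ∀ u → i ≤ u → u < i + p → y u ≡ y (u + p)

square⇒periodic : ∀ {A : Set} {y : ℕ → A} i k → Square y i k → Periodic y i (suc k)
square⇒periodic {y = y} i k sq u i≤u u<end = begin
  y u                 ≡⟨ cong y (m+[n∸m]≡n i≤u) ⟨
  y (i + d)           ≡⟨ sq d (+-cancelˡ-< i d (suc k) (subst (_< i + suc k) (sym (m+[n∸m]≡n i≤u)) u<end)) ⟩
  y (i + suc k + d)   ≡⟨ cong y (regroup i (suc k) d) ⟩
  y (i + d + suc k)   ≡⟨ cong (λ v → y (v + suc k)) (m+[n∸m]≡n i≤u) ⟩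
  y (u + suc k)       ∎
  where
  open ≡-Reasoning
  d : ℕ
  d = u ∸ i
  regroup : ∀ a b c → a + b + c ≡ a + c + b
  regroup = solve-∀

-- Uniform morphisms and desubstitution

module Uniform {a′ b′ : ℕ} (L′ : ℕ) (image : Fin (suc a′) → Vec (Fin (suc b′)) (suc L′)) where

  A B : Set
  A = Fin (suc a′)
  B = Fin (suc b′)

  L : ℕ
  L = suc L′

  letter : A → ℕ → B
  letter c r = lookupVec zero (image c) r

  apply : (ℕ → A) → ℕ → B
  apply x t = letter (x (t / L)) (t % L)

  apply-block : ∀ x q r → r < L → apply x (q * L + r) ≡ letter (x q) r
  apply-block x q r r<L = cong₂ (λ q′ r′ → letter (x q′) r′) quotient remainder
    where
    quotient : (q * L + r) / L ≡ q
    quotient = begin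
      (q * L + r) / L      ≡⟨ +-distrib-/-∣ˡ r (n∣m*n q) ⟩
      q * L / L + r / L    ≡⟨ cong₂ _+_ (m*n/n≡m q L) (m<n⇒m/n≡0 r<L) ⟩
      q + 0                ≡⟨ +-identityʳ q ⟩
      q                    ∎
      where open ≡-Reasoning
    remainder : (q * L + r) % L ≡ r
    remainder = trans (%-remove-+ˡ r (n∣m*n q)) (m<n⇒m%n≡m r<L)

  quotient-remainder : ∀ t → t ≡ t / L * L + t % L
  quotient-remainder t = trans (m≡m%n+[m/n]*n t L) (+-comm (t % L) _)

  divMod : ∀ t → Σ ℕ λ q → Σ ℕ λ r → r < L × t ≡ q * L + r
  divMod t = t / L , t % L , m%n<n t L , quotient-remainder t

  apply-window : ∀ x q n t → t < n * L → apply (lookupVec zero (window x q n)) t ≡ apply x (q * L + t)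
  apply-window x q n t t<nL = begin
    letter (lookupVec zero (window x q n) (t / L)) (t % L)   ≡⟨ cong (λ c → letter c (t % L))
                                                                 (lookupVec-window zero x q n (t / L) (m<n*o⇒m/o<n t<nL)) ⟩
    letter (x (q + t / L)) (t % L)                          ≡⟨ apply-block x (q + t / L) (t % L) (m%n<n t L) ⟨
    apply x ((q + t / L) * L + t % L)                       ≡⟨ cong (apply x) (regroup q (t / L) (t % L) L) ⟩
    apply x (q * L + (t / L * L + t % L))                   ≡⟨ cong (λ s → apply x (q * L + s)) (quotient-remainder t) ⟨
    apply x (q * L + t)                                     ∎
    where
    open ≡-Reasoning
    regroup : ∀ q a b c → (q + a) * c + b ≡ q * c + (a * c + b)
    regroup = solve-∀

  module Walks (follows : A → A → Bool) where

    _↝_ : A → A → Set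
    a ↝ c = T (follows a c)

    isWalkVec : ∀ {n} → Vec A n → Bool
    isWalkVec [] = true
    isWalkVec (a ∷ []) = true
    isWalkVec (a ∷ c ∷ v) = follows a c ∧ isWalkVec (c ∷ v)

    isWalkVec-window : ∀ x → IsWalk _↝_ x → ∀ q n → T (isWalkVec (window x q n))
    isWalkVec-window x walk q zero = tt
    isWalkVec-window x walk q (suc zero) = tt
    isWalkVec-window x walk q (suc (suc n)) = ∧-intro (walk q) (isWalkVec-window x walk (suc q) (suc n))

    joinᵇ : (B → B → Bool) → A → A → Bool
    joinᵇ R a c = not (follows a c) ∨ R (letter a L′) (letter c 0)

    imageInternalᵇ imageJoinᵇ imagesWalkᵇ : (B → B → Bool) → Bool
    imageInternalᵇ R = allFin λ a → allBelow L′ λ r → R (letter a r) (letter a (suc r))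
    imageJoinᵇ R = allFin λ a → allFin (joinᵇ R a)
    imagesWalkᵇ R = imageInternalᵇ R ∧ imageJoinᵇ R

    imageInternal : ∀ R → T (imagesWalkᵇ R) → ∀ a r → r < L′ → T (R (letter a r) (letter a (suc r)))
    imageInternal R cert a =
      allBelow-sound L′ (λ r → R (letter a r) (letter a (suc r)))
        (allFin-sound (λ a → allBelow L′ λ r → R (letter a r) (letter a (suc r))) (∧-elimˡ {imageInternalᵇ R} cert) a)

    imageJoin : ∀ R → T (imagesWalkᵇ R) → ∀ a c → a ↝ c → T (R (letter a L′) (letter c 0))
    imageJoin R cert a c = modusPonens {follows a c}
      (allFin-sound (joinᵇ R a) (allFin-sound (λ a → allFin (joinᵇ R a)) (∧-elimʳ {imageInternalᵇ R} cert) a) c)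

    apply-step : ∀ R → T (imagesWalkᵇ R) → ∀ x q r → r < L → (r ≡ L′ → x q ↝ x (suc q)) →
                 T (R (apply x (q * L + r)) (apply x (suc (q * L + r))))
    apply-step R cert x q r r<L boundary with m≤n⇒m<n∨m≡n (≤-pred r<L)
    ... | inj₁ r<L′ =
      subst₂ (λ u v → T (R u v)) (sym (apply-block x q r r<L))
        (sym (trans (cong (apply x) (sym (+-suc (q * L) r))) (apply-block x q (suc r) (s≤s r<L′))))
        (imageInternal R cert (x q) r r<L′)
    ... | inj₂ refl =
      subst₂ (λ u v → T (R u v)) (sym (apply-block x q r r<L))
        (sym (trans (cong (apply x) (regroup q r)) (apply-block x (suc q) 0 (s≤s z≤n))))
        (imageJoin R cert (x q) (x (suc q)) (boundary refl))
      where
      regroup : ∀ q l → suc (q * suc l + l) ≡ suc q * suc l + 0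
      regroup = solve-∀

    apply-isWalk : ∀ R → T (imagesWalkᵇ R) → ∀ x → IsWalk _↝_ x → IsWalk (λ u v → T (R u v)) (apply x)
    apply-isWalk R cert x walk t with divMod t
    ... | q , r , r<L , refl = apply-step R cert x q r r<L (λ _ → walk q)

    module Desubstitution (W nb : ℕ) where

      distinctImagesᵇ : A → A → Bool
      distinctImagesᵇ a c = (a == c) ∨ not (agreeOn L (letter a) (letter c))

      injectiveᵇ : Bool
      injectiveᵇ = allFin λ a → allFin (distinctImagesᵇ a)

      misalignedᵇ : Vec A (suc W) → Vec A W → Bool
      misalignedᵇ c d = allBelow L′ λ s →
        not (agreeOn (W * L) (λ t → apply (lookupVec zero c) (suc s + t)) (apply (lookupVec zero d)))

      synchronisingᵇ : Bool
      synchronisingᵇ = allVec (suc W) λ c → not (isWalkVec c) ∨ allVec W λ d → not (isWalkVec d) ∨ misalignedᵇ c d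

      cutAtᵇ : A → A → A → Bool
      cutAtᵇ a b c = (a == b) ∨ (b == c) ∨ allBelow L′ λ r →
        not (agreeOn (L ∸ suc r) (λ t → letter a (suc r + t)) (λ t → letter b (suc r + t))
             ∧ agreeOn (suc r) (letter b) (letter c))

      cutᵇ : Bool
      cutᵇ = allFin λ a → allFin λ b → allFin (cutAtᵇ a b)

      shortLimit : ℕ
      shortLimit = suc W * L ∸ 2

      noShortSquareᵇ : Vec A nb → Bool
      noShortSquareᵇ v = allBelow L λ i → allBelow shortLimit λ k →
        not (agreeOn (suc k) (λ t → apply (lookupVec zero v) (i + t)) (λ t → apply (lookupVec zero v) (i + suc k + t)))

      shortSquaresᵇ : Bool
      shortSquaresᵇ = allVec nb λ v → not (isWalkVec v) ∨ squareWithin (lookupVec zero v) nb ∨ noShortSquareᵇ v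

      image-injective : T injectiveᵇ → ∀ a c → (∀ t → t < L → letter a t ≡ letter c t) → a ≡ c
      image-injective cert a c same
        with ∨-elim (allFin-sound (distinctImagesᵇ a) (allFin-sound (λ a → allFin (distinctImagesᵇ a)) cert a) c)
      ... | inj₁ a≡c = ==-sound a≡c
      ... | inj₂ differ = ⊥-elim (not-elim differ (agreeOn-complete L (letter a) (letter c) same))

      synchronised : T synchronisingᵇ → ∀ c d → T (isWalkVec c) → T (isWalkVec d) → ∀ s → s < L′ →
        ¬ (∀ t → t < W * L → apply (lookupVec zero c) (suc s + t) ≡ apply (lookupVec zero d) t)
      synchronised cert c d walk-c walk-d s s<L′ same =
        not-elim (allBelow-sound L′ _ misaligned s s<L′) (agreeOn-complete (W * L) _ _ same)
        where
        forEach-d : Vec A (suc W) → Vec A W → Bool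
        forEach-d c d = not (isWalkVec d) ∨ misalignedᵇ c d
        misaligned : T (misalignedᵇ c d)
        misaligned = modusPonens {isWalkVec d}
          (allVec-sound W (forEach-d c)
            (modusPonens {isWalkVec c}
              (allVec-sound (suc W) (λ c → not (isWalkVec c) ∨ allVec W (forEach-d c)) cert c) walk-c)
            d)
          walk-d

      cut-sound : T cutᵇ → ∀ a b c r → r < L′ →
        (∀ t → t < L ∸ suc r → letter a (suc r + t) ≡ letter b (suc r + t)) →
        (∀ t → t < suc r → letter b t ≡ letter c t) → a ≡ b ⊎ b ≡ c
      cut-sound cert a b c r r<L′ suffixes prefixes
        with ∨-elim (allFin-sound (cutAtᵇ a b) (allFin-sound (λ b → allFin (cutAtᵇ a b))
                                                 (allFin-sound (λ a → allFin λ b → allFin (cutAtᵇ a b)) cert a) b) c)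
      ... | inj₁ a≡b = inj₁ (==-sound a≡b)
      ... | inj₂ rest with ∨-elim {b == c} rest
      ...   | inj₁ b≡c = inj₂ (==-sound b≡c)
      ...   | inj₂ cuts = ⊥-elim (not-elim (allBelow-sound L′ _ cuts r r<L′)
                            (∧-intro (agreeOn-complete _ _ _ suffixes) (agreeOn-complete _ _ _ prefixes)))

      short-sound : T shortSquaresᵇ → ∀ v → T (isWalkVec v) →
        T (squareWithin (lookupVec zero v) nb) ⊎
        (∀ i k → i < L → k < shortLimit → ¬ Square (apply (lookupVec zero v)) i k)
      short-sound cert v walk-v with ∨-elim (modusPonens {isWalkVec v}
                                       (allVec-sound nb (λ v → not (isWalkVec v) ∨ _) cert v) walk-v)
      ... | inj₁ found = inj₁ found
      ... | inj₂ none = inj₂ λ i k i<L k<lim sq →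
              not-elim (allBelow-sound shortLimit _ (allBelow-sound L _ none i i<L) k k<lim)
                       (agreeOn-complete (suc k) _ _ sq)

      -- The bound on where the pulled-back square ends drives the induction in fixedPoint-squareFree.
      PreimageSquare : (ℕ → A) → ℕ → Set
      PreimageSquare x e = Σ ℕ λ i → Σ ℕ λ k → Square x i k × L * (i + suc k + suc k) ≤ L * nb + e

      module _ (x : ℕ → A) (walk : IsWalk _↝_ x)
               (injective : T injectiveᵇ) (synchronising : T synchronisingᵇ) (cut : T cutᵇ)
               (short : T shortSquaresᵇ) (long-window : L + shortLimit + shortLimit ≤ nb * L) where

        private
          y : ℕ → B
          y = apply x

        nb-positive : 1 ≤ nb
        nb-positive = *-cancelʳ-≤ 1 nb L
          (≤-trans (≤-reflexive (*-identityˡ L)) (≤-trans (m≤m+n L _) (≤-trans (m≤m+n _ shortLimit) long-window)))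

        short-square : ∀ q r k → r < L → Square y (q * L + r) k → suc k + 2 ≤ suc W * L →
                       PreimageSquare x (q * L + r + suc k + suc k)
        short-square q r k r<L sq short-period with short-sound short (window x q nb) (isWalkVec-window x walk q nb)
        ... | inj₁ found =
          let (i′ , k′ , fits , sq′) = squareWithin-sound (lookupVec zero (window x q nb)) nb found
          in q + i′ , k′ , square-in-window zero x q nb i′ k′ fits sq′ , bound i′ k′ fits
          where
          bound : ∀ i′ k′ → i′ + suc k′ + suc k′ ≤ nb →
                  L * (q + i′ + suc k′ + suc k′) ≤ L * nb + (q * L + r + suc k + suc k)
          bound i′ k′ fits = begin
            L * (q + i′ + suc k′ + suc k′)          ≡⟨ cong (L *_) (regroup q i′ (suc k′) (suc k′)) ⟩
            L * (q + (i′ + suc k′ + suc k′))        ≤⟨ *-monoʳ-≤ L (+-monoʳ-≤ q fits) ⟩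
            L * (q + nb)                            ≡⟨ regroup′ L q nb ⟩
            L * nb + q * L                          ≤⟨ +-monoʳ-≤ (L * nb) (m≤m+n (q * L) (r + suc k + suc k)) ⟩
            L * nb + (q * L + (r + suc k + suc k))  ≡⟨ cong (L * nb +_) (regroup (q * L) r (suc k) (suc k)) ⟨
            L * nb + (q * L + r + suc k + suc k)    ∎
            where
            open ≤-Reasoning
            regroup : ∀ a b c d → a + b + c + d ≡ a + (b + c + d)
            regroup = solve-∀
            regroup′ : ∀ a b c → a * (b + c) ≡ a * c + b * a
            regroup′ = solve-∀
        ... | inj₂ none = ⊥-elim (none r k r<L k<limit inWindow)
          where
          k<limit : k < shortLimit
          k<limit = m+n≤o⇒m≤o∸n (suc k) short-period
          inside : ∀ t → t < suc k → r + suc k + t < nb * L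
          inside t t<p = <-≤-trans (+-mono-≤ (+-mono-≤ r<L k<limit) (≤-trans (≤-pred t<p) (<⇒≤ k<limit))) long-window
          inWindow : Square (apply (lookupVec zero (window x q nb))) r k
          inWindow t t<p = begin
            apply (lookupVec zero (window x q nb)) (r + t)          ≡⟨ apply-window x q nb (r + t)
                                                                        (≤-<-trans (+-monoˡ-≤ t (m≤m+n r (suc k))) (inside t t<p)) ⟩
            y (q * L + (r + t))                                     ≡⟨ cong y (+-assoc (q * L) r t) ⟨
            y (q * L + r + t)                                       ≡⟨ sq t t<p ⟩
            y (q * L + r + suc k + t)                               ≡⟨ cong y (regroup (q * L) r (suc k) t) ⟩
            y (q * L + (r + suc k + t))                             ≡⟨ apply-window x q nb (r + suc k + t) (inside t t<p) ⟨
            apply (lookupVec zero (window x q nb)) (r + suc k + t)  ∎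
            where
            open ≡-Reasoning
            regroup : ∀ a b c d → a + b + c + d ≡ a + (b + c + d)
            regroup = solve-∀

        next-boundary : ∀ q r → r < L → Σ ℕ λ b → q * L + r ≤ b * L × b * L ≤ q * L + r + L′
        next-boundary q zero _ = q , ≤-reflexive (+-identityʳ _) , ≤-trans (m≤m+n (q * L) 0) (m≤m+n _ L′)
        next-boundary q (suc r) r<L = suc q , after , before
          where
          after : q * L + suc r ≤ suc q * L
          after = ≤-trans (+-monoʳ-≤ (q * L) (<⇒≤ r<L)) (≤-reflexive (+-comm (q * L) L))
          before : suc q * L ≤ q * L + suc r + L′
          before = ≤-trans (≤-reflexive (regroup (q * L) L′)) (+-monoˡ-≤ L′ (+-monoʳ-≤ (q * L) (s≤s z≤n)))
            where
            regroup : ∀ a l → suc l + a ≡ a + 1 + l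
            regroup = solve-∀

        -- The long square contains the image of a walk of length W starting at the block boundary b,
        -- which reappears one period later; synchronisation forces that occurrence onto a boundary.
        period-aligned : ∀ i k b → Square y i k → i ≤ b * L → b * L ≤ i + L′ → suc W * L ≤ suc (suc k) →
                         Σ ℕ λ l → l * L ≡ suc k
        period-aligned i k b sq i≤bL bL≤ long-period with divMod (b * L + suc k)
        ... | q , zero , _ , split = q ∸ b , (begin
            (q ∸ b) * L                ≡⟨ *-distribʳ-∸ L q b ⟩
            q * L ∸ b * L              ≡⟨ cong (_∸ b * L) (trans (sym (+-identityʳ (q * L))) (sym split)) ⟩
            b * L + suc k ∸ b * L      ≡⟨ m+n∸m≡n (b * L) (suc k) ⟩
            suc k                      ∎)
          where open ≡-Reasoning
        ... | q , suc s , s<L , split =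
          ⊥-elim (synchronised synchronising (window x q (suc W)) (window x b W)
            (isWalkVec-window x walk q (suc W)) (isWalkVec-window x walk b W) s (≤-pred s<L) shifted)
          where
          shifted : ∀ t → t < W * L → apply (lookupVec zero (window x q (suc W))) (suc s + t)
                                       ≡ apply (lookupVec zero (window x b W)) t
          shifted t t<WL = begin
            apply (lookupVec zero (window x q (suc W))) (suc s + t)  ≡⟨ apply-window x q (suc W) (suc s + t) (+-mono-< s<L t<WL) ⟩
            y (q * L + (suc s + t))                                  ≡⟨ cong y (+-assoc (q * L) (suc s) t) ⟨
            y (q * L + suc s + t)                                    ≡⟨ cong (λ v → y (v + t)) split ⟨
            y (b * L + suc k + t)                                    ≡⟨ cong y (regroup (b * L) (suc k) t) ⟩
            y (b * L + t + suc k)                                    ≡⟨ square⇒periodic {y = y} i k sq (b * L + t) i≤u u<end ⟨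
            y (b * L + t)                                            ≡⟨ apply-window x b W t t<WL ⟨
            apply (lookupVec zero (window x b W)) t                  ∎
            where
            open ≡-Reasoning
            regroup : ∀ a b c → a + b + c ≡ a + c + b
            regroup = solve-∀
            i≤u : i ≤ b * L + t
            i≤u = ≤-trans i≤bL (m≤m+n (b * L) t)
            u<end : b * L + t < i + suc k
            u<end = <-≤-trans (+-mono-≤-< bL≤ t<WL) (≤-trans (≤-reflexive (+-assoc i L′ (W * L)))
                                                      (+-monoʳ-≤ i (≤-pred long-period)))

        block-repeats : ∀ i k m q → Square y i k → suc m * L ≡ suc k → i ≤ q * L → suc q * L ≤ i + suc k →
                        x q ≡ x (q + suc m)
        block-repeats i k m q sq period i≤qL qL≤ = image-injective injective (x q) (x (q + suc m)) λ t t<L → begin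
          letter (x q) t               ≡⟨ apply-block x q t t<L ⟨
          y (q * L + t)                ≡⟨ square⇒periodic {y = y} i k sq (q * L + t)
                                            (≤-trans i≤qL (m≤m+n (q * L) t)) (u<end t t<L) ⟩
          y (q * L + t + suc k)        ≡⟨ cong (λ p → y (q * L + t + p)) period ⟨
          y (q * L + t + suc m * L)    ≡⟨ cong y (regroup q t (suc m) L) ⟩
          y ((q + suc m) * L + t)      ≡⟨ apply-block x (q + suc m) t t<L ⟩
          letter (x (q + suc m)) t     ∎
          where
          open ≡-Reasoning
          regroup : ∀ q t m l → q * l + t + m * l ≡ (q + m) * l + t
          regroup = solve-∀
          u<end : ∀ t → t < L → q * L + t < i + suc k
          u<end t t<L = <-≤-trans (+-monoʳ-< (q * L) t<L) (≤-trans (≤-reflexive (+-comm (q * L) L)) qL≤)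

        long-bound : ∀ q r k m i′ → suc m * L ≡ suc k → i′ ≤ suc q →
                     L * (i′ + suc m + suc m) ≤ L * nb + (q * L + r + suc k + suc k)
        long-bound q r k m i′ period i′≤ = begin
          L * (i′ + suc m + suc m)                ≤⟨ *-monoʳ-≤ L (+-monoˡ-≤ (suc m) (+-monoˡ-≤ (suc m) i′≤)) ⟩
          L * (suc q + suc m + suc m)             ≡⟨ expand L q (suc m) ⟩
          L * 1 + q * L + suc m * L + suc m * L   ≡⟨ cong₂ (λ u v → L * 1 + q * L + u + v) period period ⟩
          L * 1 + q * L + suc k + suc k           ≤⟨ +-monoˡ-≤ (suc k) (+-monoˡ-≤ (suc k)
                                                       (+-mono-≤ (*-monoʳ-≤ L nb-positive) (m≤m+n (q * L) r))) ⟩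
          L * nb + (q * L + r) + suc k + suc k    ≡⟨ regroup (L * nb) (q * L + r) (suc k) ⟩
          L * nb + (q * L + r + suc k + suc k)    ∎
          where
          open ≤-Reasoning
          expand : ∀ l q m → l * (suc q + m + m) ≡ l * 1 + q * l + m * l + m * l
          expand = solve-∀
          regroup : ∀ a b c → a + b + c + c ≡ a + (b + c + c)
          regroup = solve-∀

        inner-blocks-repeat : ∀ q r k m → r < L → Square y (q * L + r) k → suc m * L ≡ suc k →
                              ∀ j → j < m → x (q + suc j) ≡ x (q + suc m + suc j)
        inner-blocks-repeat q r k m r<L sq period j j<m =
          trans (block-repeats (q * L + r) k m (q + suc j) sq period start end) (cong x (regroup q (suc j) (suc m)))
          where
          regroup : ∀ a b c → a + b + c ≡ a + c + b
          regroup = solve-∀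
          start : q * L + r ≤ (q + suc j) * L
          start = begin
            q * L + r          ≤⟨ +-monoʳ-≤ (q * L) (<⇒≤ r<L) ⟩
            q * L + L          ≡⟨ +-comm (q * L) L ⟩
            suc q * L          ≤⟨ *-monoˡ-≤ L (s≤s (m≤m+n q j)) ⟩
            suc (q + j) * L    ≡⟨ cong (_* L) (+-suc q j) ⟨
            (q + suc j) * L    ∎
            where open ≤-Reasoning
          end : suc (q + suc j) * L ≤ q * L + r + suc k
          end = begin
            suc (q + suc j) * L     ≤⟨ *-monoˡ-≤ L (subst (_≤ q + suc m) (+-suc q (suc j)) (+-monoʳ-≤ q (s≤s j<m))) ⟩
            (q + suc m) * L         ≡⟨ *-distribʳ-+ L q (suc m) ⟩
            q * L + suc m * L       ≡⟨ cong (q * L +_) period ⟩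
            q * L + suc k           ≤⟨ +-monoˡ-≤ (suc k) (m≤m+n (q * L) r) ⟩
            q * L + r + suc k       ∎
            where open ≤-Reasoning

        cut-suffixes-agree : ∀ q r k m → suc r < L → Square y (q * L + suc r) k → suc m * L ≡ suc k →
          ∀ t → t < L ∸ suc r → letter (x q) (suc r + t) ≡ letter (x (q + suc m)) (suc r + t)
        cut-suffixes-agree q r k m r<L sq period t t<rest = begin
          letter (x q) (suc r + t)                     ≡⟨ apply-block x q (suc r + t) rt<L ⟨
          y (q * L + (suc r + t))                      ≡⟨ cong y (+-assoc (q * L) (suc r) t) ⟨
          y (q * L + suc r + t)                        ≡⟨ square⇒periodic {y = y} (q * L + suc r) k sq (q * L + suc r + t)
                                                            (m≤m+n (q * L + suc r) t) (+-monoʳ-< (q * L + suc r) t<period) ⟩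
          y (q * L + suc r + t + suc k)                ≡⟨ cong (λ p → y (q * L + suc r + t + p)) period ⟨
          y (q * L + suc r + t + suc m * L)            ≡⟨ cong y (regroup q (suc r) t (suc m) L) ⟩
          y ((q + suc m) * L + (suc r + t))            ≡⟨ apply-block x (q + suc m) (suc r + t) rt<L ⟩
          letter (x (q + suc m)) (suc r + t)           ∎
          where
          open ≡-Reasoning
          rt<L : suc r + t < L
          rt<L = subst (suc r + t <_) (m+[n∸m]≡n (<⇒≤ r<L)) (+-monoʳ-< (suc r) t<rest)
          t<period : t < suc k
          t<period = <-≤-trans (≤-<-trans (m≤n+m t (suc r)) rt<L) (subst (L ≤_) period (m≤m+n L (m * L)))
          regroup : ∀ q r t m l → q * l + r + t + m * l ≡ (q + m) * l + (r + t)
          regroup = solve-∀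

        cut-prefixes-agree : ∀ q r k m → suc r < L → Square y (q * L + suc r) k → suc m * L ≡ suc k →
          ∀ t → t < suc r → letter (x (q + suc m)) t ≡ letter (x (q + suc m + suc m)) t
        cut-prefixes-agree q r k m r<L sq period t t≤r = begin
          letter (x (q + suc m)) t              ≡⟨ apply-block x (q + suc m) t t<L ⟨
          y ((q + suc m) * L + t)               ≡⟨ square⇒periodic {y = y} (q * L + suc r) k sq ((q + suc m) * L + t) start end ⟩
          y ((q + suc m) * L + t + suc k)       ≡⟨ cong (λ p → y ((q + suc m) * L + t + p)) period ⟨
          y ((q + suc m) * L + t + suc m * L)   ≡⟨ cong y (regroup q (suc m) t L) ⟩
          y ((q + suc m + suc m) * L + t)       ≡⟨ apply-block x (q + suc m + suc m) t t<L ⟩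
          letter (x (q + suc m + suc m)) t      ∎
          where
          open ≡-Reasoning
          t<L : t < L
          t<L = <-trans t≤r r<L
          regroup : ∀ q m t l → (q + m) * l + t + m * l ≡ (q + m + m) * l + t
          regroup = solve-∀
          unfold : (q + suc m) * L + t ≡ q * L + suc k + t
          unfold = trans (cong (_+ t) (*-distribʳ-+ L q (suc m))) (cong (λ p → q * L + p + t) period)
          start : q * L + suc r ≤ (q + suc m) * L + t
          start = ≤-trans (+-monoʳ-≤ (q * L) (≤-trans (<⇒≤ r<L) (subst (L ≤_) period (m≤m+n L (m * L)))))
                    (≤-trans (m≤m+n (q * L + suc k) t) (≤-reflexive (sym unfold)))
          end : (q + suc m) * L + t < q * L + suc r + suc k
          end = subst (_< q * L + suc r + suc k) (sym unfold)
                  (subst (q * L + suc k + t <_) (regroup′ (q * L) (suc k) (suc r)) (+-monoʳ-< (q * L + suc k) t≤r))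
            where
            regroup′ : ∀ a b c → a + b + c ≡ a + c + b
            regroup′ = solve-∀

        -- Blocks strictly inside the square repeat; a square cutting into its first block is either
        -- extended to that whole block or shifted one block to the right, by the cut certificate.
        periodic-square : ∀ q r k m → r < L → Square y (q * L + r) k → suc m * L ≡ suc k →
                          PreimageSquare x (q * L + r + suc k + suc k)
        periodic-square q zero k m _ sq period =
          q , m , square , long-bound q zero k m q period (n≤1+n q)
          where
          square : Square x q m
          square zero _ = trans (cong x (+-identityʳ q))
            (trans (block-repeats (q * L + 0) k m q sq period (≤-reflexive (+-identityʳ _)) end) (cong x (sym (+-identityʳ _))))
            where
            end : suc q * L ≤ q * L + 0 + suc k
            end = ≤-trans (≤-reflexive (+-comm L (q * L)))
                    (+-mono-≤ (≤-reflexive (sym (+-identityʳ _))) (subst (L ≤_) period (m≤m+n L (m * L))))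
          square (suc j) j<m = inner-blocks-repeat q zero k m (s≤s z≤n) sq period j (≤-pred j<m)
        periodic-square q (suc r) k m r<L sq period
          with cut-sound cut (x q) (x (q + suc m)) (x (q + suc m + suc m)) r (≤-pred r<L)
                 (cut-suffixes-agree q r k m r<L sq period) (cut-prefixes-agree q r k m r<L sq period)
        ... | inj₁ a≡b = q , m , square , long-bound q (suc r) k m q period (n≤1+n q)
          where
          square : Square x q m
          square zero _ = trans (cong x (+-identityʳ q)) (trans a≡b (cong x (sym (+-identityʳ _))))
          square (suc j) j<m = inner-blocks-repeat q (suc r) k m r<L sq period j (≤-pred j<m)
        ... | inj₂ b≡c = suc q , m , square , long-bound q (suc r) k m (suc q) period ≤-refl
          where
          square : Square x (suc q) m
          square j j≤m with m≤n⇒m<n∨m≡n (≤-pred j≤m)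
          ... | inj₁ j<m = trans (cong x (sym (+-suc q j)))
                  (trans (inner-blocks-repeat q (suc r) k m r<L sq period j j<m) (cong x (regroup q m j)))
            where
            regroup : ∀ q m j → q + suc m + suc j ≡ suc q + suc m + j
            regroup = solve-∀
          ... | inj₂ refl = trans (cong x (sym (+-suc q j))) (trans b≡c (cong x (regroup q j)))
            where
            regroup : ∀ q m → q + suc m + suc m ≡ suc q + suc m + m
            regroup = solve-∀

        long-square : ∀ q r k → r < L → Square y (q * L + r) k → suc W * L ≤ suc (suc k) →
                      PreimageSquare x (q * L + r + suc k + suc k)
        long-square q r k r<L sq long-period with next-boundary q r r<L
        ... | b , i≤bL , bL≤ with period-aligned (q * L + r) k b sq i≤bL bL≤ long-period
        ...   | zero , ()
        ...   | suc m , period = periodic-square q r k m r<L sq period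

        square-desubstitutes : ∀ i k → Square y i k → PreimageSquare x (i + suc k + suc k)
        square-desubstitutes i k sq with divMod i
        ... | q , r , r<L , refl with suc k + 2 ≤? suc W * L
        ...   | yes short-period = short-square q r k r<L sq short-period
        ...   | no ¬short = long-square q r k r<L sq (≤-pred (≰⇒> (¬short ∘′ subst (_≤ suc W * L) (+-comm 2 (suc k)))))

        apply-squareFree : SquareFree x → SquareFree y
        apply-squareFree squareFree i k sq =
          let (i′ , k′ , sq′ , _) = square-desubstitutes i k sq in squareFree i′ k′ sq′

-- Fixed points of uniform morphisms

module FixedPoint {a′ : ℕ} (L″ : ℕ) (image : Fin (suc a′) → Vec (Fin (suc a′)) (suc (suc L″)))
                  (seed : Fin (suc a′)) (prolongable : lookupVec zero (image seed) 0 ≡ seed) where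

  open Uniform (suc L″) image public

  -- iterate d n is the n-th letter of h^d(seed); it no longer changes once d ≥ n.
  iterate : ℕ → ℕ → A
  iterate zero n = seed
  iterate (suc d) n = letter (iterate d (n / L)) (n % L)

  fixedPoint : ℕ → A
  fixedPoint n = iterate n n

  private
    quotient≤ : ∀ n d → n ≤ suc d → n / L ≤ d
    quotient≤ zero d _ = z≤n
    quotient≤ (suc n) d n≤ = ≤-pred (<-≤-trans (m/n<m (suc n) L (s≤s (s≤s z≤n))) n≤)

  iterate-step : ∀ d n → n ≤ d → iterate d n ≡ iterate (suc d) n
  iterate-step zero zero _ = sym prolongable
  iterate-step (suc d) n n≤ = cong (λ c → letter c (n % L)) (iterate-step d (n / L) (quotient≤ n d n≤))

  iterate-stable : ∀ {d d′} n → n ≤ d → d ≤′ d′ → iterate d n ≡ iterate d′ n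
  iterate-stable n n≤d ≤′-refl = refl
  iterate-stable n n≤d (≤′-step d≤d′) =
    trans (iterate-stable n n≤d d≤d′) (iterate-step _ n (≤-trans n≤d (≤′⇒≤ d≤d′)))

  fixedPoint-fixed : ∀ n → fixedPoint n ≡ apply fixedPoint n
  fixedPoint-fixed zero = sym prolongable
  fixedPoint-fixed (suc n) = cong (λ c → letter c (suc n % L))
    (sym (iterate-stable (suc n / L) ≤-refl (≤⇒≤′ (quotient≤ (suc n) n ≤-refl))))

  module _ (follows : A → A → Bool) where

    open Walks follows

    -- Position q L + L′ ends a block, and q < q L + L′ since L′ > 0: strong induction.
    fixedPoint-isWalk : T (imagesWalkᵇ follows) → IsWalk _↝_ fixedPoint
    fixedPoint-isWalk cert = <-rec _ step
      where
      step : ∀ n → (∀ {m} → m < n → fixedPoint m ↝ fixedPoint (suc m)) → fixedPoint n ↝ fixedPoint (suc n)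
      step n earlier with divMod n
      ... | q , r , r<L , refl =
        subst₂ _↝_ (sym (fixedPoint-fixed (q * L + r))) (sym (fixedPoint-fixed (suc (q * L + r))))
          (apply-step follows cert fixedPoint q r r<L λ { refl → earlier (q<end q) })
        where
        q<end : ∀ q → q < q * L + suc L″
        q<end q = subst (q <_) (sym (+-suc (q * L) L″)) (s≤s (≤-trans (m≤m*n q L) (m≤m+n (q * L) L″)))

    module _ (W nb : ℕ) where

      open Desubstitution W nb

      -- Induction on where a square ends: it pulls back to a square ending earlier unless it ends
      -- within 2 nb, where a finite check excludes it.
      fixedPoint-squareFree : T (imagesWalkᵇ follows) → T injectiveᵇ → T synchronisingᵇ → T cutᵇ →
        T shortSquaresᵇ → L + shortLimit + shortLimit ≤ nb * L →
        ¬ T (squareWithin fixedPoint (nb + nb)) → SquareFree fixedPoint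
      fixedPoint-squareFree walk injective synchronising cut short long-window prefix i k sq =
        <-rec Excluded step (i + suc k + suc k) i k refl sq
        where
        Excluded : ℕ → Set
        Excluded e = ∀ i k → i + suc k + suc k ≡ e → ¬ Square fixedPoint i k
        step : ∀ e → (∀ {e′} → e′ < e → Excluded e′) → Excluded e
        step e shorter i k refl sq
          with square-desubstitutes fixedPoint (fixedPoint-isWalk walk) injective synchronising cut short long-window i k
                 (λ j j<p → trans (sym (fixedPoint-fixed (i + j))) (trans (sq j j<p) (fixedPoint-fixed (i + suc k + j))))
        ... | i′ , k′ , sq′ , bound with i′ + suc k′ + suc k′ <? e
        ...   | yes earlier = shorter earlier i′ k′ refl sq′
        ...   | no ¬earlier = prefix (squareWithin-complete fixedPoint (nb + nb) i k withinPrefix sq)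
          where
          withinPrefix : e ≤ nb + nb
          withinPrefix = *-cancelˡ-≤ (suc L″) (begin
            suc L″ * e                ≡⟨ m+n∸m≡n e (suc L″ * e) ⟨
            L * e ∸ e                 ≤⟨ ∸-monoˡ-≤ e (≤-trans (*-monoʳ-≤ L (≮⇒≥ ¬earlier)) bound) ⟩
            L * nb + e ∸ e            ≡⟨ m+n∸n≡m (L * nb) e ⟩
            nb + suc L″ * nb          ≤⟨ +-monoˡ-≤ (suc L″ * nb) (m≤m*n nb (suc L″)) ⟩
            nb * suc L″ + suc L″ * nb ≡⟨ regroup nb L″ ⟩
            suc L″ * (nb + nb)        ∎)
            where
            open ≤-Reasoning
            regroup : ∀ n l → n * suc l + suc l * n ≡ suc l * (n + n)
            regroup = solve-∀

-- Exhaustive searches over walks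

lookupList : {A : Set} → A → List A → ℕ → A
lookupList d [] n = d
lookupList d (x ∷ l) zero = x
lookupList d (x ∷ l) (suc n) = lookupList d l n

lookupList-applyUpTo : ∀ {A : Set} (d : A) f n j → j < n → lookupList d (applyUpTo f n) j ≡ f j
lookupList-applyUpTo d f (suc n) zero _ = refl
lookupList-applyUpTo d f (suc n) (suc j) j<n = lookupList-applyUpTo d (f ∘ suc) n j (≤-pred j<n)

allList anyList : {A : Set} → (A → Bool) → List A → Bool
allList P [] = true
allList P (x ∷ l) = P x ∧ allList P l
anyList P [] = false
anyList P (x ∷ l) = P x ∨ anyList P l

allList-anyList : {A : Set} (P Q : A → Bool) (l : List A) → T (allList P l) → T (anyList Q l) →
  Σ A λ v → T (P v) × T (Q v)
allList-anyList P Q (x ∷ l) all any with ∨-elim {Q x} any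
... | inj₁ q = x , ∧-elimˡ all , q
... | inj₂ q = allList-anyList P Q l (∧-elimʳ {P x} all) q

squareSuffixᵇ : (ℕ → ℕ) → ℕ → Bool
squareSuffixᵇ u N = anyBelow N λ k → (suc k + suc k ≤ᵇ N) ∧
  allBelow (suc k) λ t → u (N ∸ (suc k + suc k) + t) ≡ᵇ u (N ∸ (suc k + suc k) + suc k + t)

squareSuffix-sound : ∀ u N → T (squareSuffixᵇ u N) → Σ ℕ λ i → Σ ℕ λ k → i + suc k + suc k ≤ N × Square u i k
squareSuffix-sound u N h =
  let (k , _ , h₁) = anyBelow-sound N _ h
      fits = ≤ᵇ⇒≤ (suc k + suc k) N (∧-elimˡ h₁)
  in N ∸ (suc k + suc k) , k ,
     ≤-reflexive (trans (+-assoc (N ∸ (suc k + suc k)) (suc k) (suc k)) (m∸n+n≡m fits)) ,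
     λ j j<p → ≡ᵇ⇒≡ _ _ (allBelow-sound (suc k) _ (∧-elimʳ {suc k + suc k ≤ᵇ N} h₁) j j<p)

square-prefix : ∀ {A B : Set} (d : A) (f : A → B) (u : ℕ → A) N i k → i + suc k + suc k ≤ N →
  Square (f ∘ lookupList d (applyUpTo u N)) i k → Square (f ∘ u) i k
square-prefix d f u N i k fits sq j j<p =
  trans (sym (cong f (lookupList-applyUpTo d u N (i + j) first)))
    (trans (sq j j<p) (cong f (lookupList-applyUpTo d u N (i + suc k + j) second)))
  where
  second : i + suc k + j < N
  second = <-≤-trans (+-monoʳ-< (i + suc k) j<p) fits
  first : i + j < N
  first = ≤-<-trans (+-monoˡ-≤ j (m≤m+n i (suc k))) second

lookupList-last : ∀ {A : Set} (d : A) u n → lookupList d (applyUpTo u (suc n)) (length (applyUpTo u (suc n)) ∸ 1) ≡ u n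
lookupList-last d u n =
  trans (cong (λ l → lookupList d (applyUpTo u (suc n)) (l ∸ 1)) (length-applyUpTo u (suc n)))
        (lookupList-applyUpTo d u (suc n) n ≤-refl)

tabulateVec : ∀ {m} {A : Set} → (Fin m → A) → Vec A m
tabulateVec {zero} f = []
tabulateVec {suc m} f = f zero ∷ tabulateVec (f ∘ suc)

lookupVec-tabulate : ∀ {m} {A : Set} (d : A) (f : Fin m → A) i → lookupVec d (tabulateVec f) (toℕ i) ≡ f i
lookupVec-tabulate d f zero = refl
lookupVec-tabulate d f (suc i) = lookupVec-tabulate d (f ∘ suc) i

NeighbourWalk : ∀ {m} → (Fin m → List (Fin m)) → (ℕ → Fin m) → Set
NeighbourWalk neighbours w = ∀ j → T (anyList (_== w (suc j)) (neighbours (w j)))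

module ColouringSearch {m′ k′ : ℕ} (neighbours : Fin (suc m′) → List (Fin (suc m′))) where

  V K : Set
  V = Fin (suc m′)
  K = Fin (suc k′)

  colourOf : Vec K (suc m′) → List V → ℕ → ℕ
  colourOf c p t = toℕ (lookupVec zero c (toℕ (lookupList zero p t)))

  lastOf : List V → V
  lastOf p = lookupList zero p (length p ∸ 1)

  -- doomed c p d: under the colouring c (a table of colours), every walk extending p meets a square
  -- within d more letters.
  doomed : Vec K (suc m′) → List V → ℕ → Bool
  doomed c p zero = false
  doomed c p (suc d) = squareSuffixᵇ (colourOf c p) (length p)
                     ∨ allList (λ v → doomed c (p ++ v ∷ []) d) (neighbours (lastOf p))

  doomed-sound : ∀ c w → NeighbourWalk neighbours w → ∀ d n → T (doomed c (applyUpTo w (suc n)) d) →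
    Σ ℕ λ i → Σ ℕ λ k → Square (lookupVec zero c ∘ toℕ ∘ w) i k
  doomed-sound c w walk (suc d) n h with ∨-elim {squareSuffixᵇ (colourOf c (applyUpTo w (suc n))) (length (applyUpTo w (suc n)))} h
  ... | inj₁ found =
    let (i , k , fits , sq) = squareSuffix-sound (colourOf c (applyUpTo w (suc n))) _ found
        fits′ = subst (i + suc k + suc k ≤_) (length-applyUpTo w (suc n)) fits
    in i , k , λ j j<p →
         Fin.toℕ-injective (square-prefix zero (λ v → toℕ (lookupVec zero c (toℕ v))) w (suc n) i k fits′ sq j j<p)
  ... | inj₂ continue =
    let (v , doomed-v , v≡next) = allList-anyList (λ v → doomed c (applyUpTo w (suc n) ++ v ∷ []) d) (_== w (suc n))
                                    (neighbours (lastOf (applyUpTo w (suc n)))) continue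
                                    (subst (λ a → T (anyList (_== w (suc n)) (neighbours a)))
                                           (sym (lookupList-last zero w n)) (walk n))
    in doomed-sound c w walk d (suc n)
         (subst (λ p → T (doomed c p d))
                (trans (cong (applyUpTo w (suc n) ∷ʳ_) (==-sound v≡next)) (applyUpTo-∷ʳ w (suc n))) doomed-v)

  allDoomedᵇ : ℕ → Bool
  allDoomedᵇ d = allVec (suc m′) λ c → allFin λ s → doomed c (s ∷ []) d

  no-squareFree-colouring : ∀ d → T (allDoomedᵇ d) → ∀ w → NeighbourWalk neighbours w → (φ : V → K) →
    Σ ℕ λ i → Σ ℕ λ k → Square (φ ∘ w) i k
  no-squareFree-colouring d cert w walk φ =
    let (i , k , sq) = doomed-sound (tabulateVec φ) w walk d 0
                         (allFin-sound (λ s → doomed (tabulateVec φ) (s ∷ []) d)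
                           (allVec-sound (suc m′) (λ c → allFin λ s → doomed c (s ∷ []) d) cert (tabulateVec φ)) (w 0))
    in i , k , λ j j<p → trans (sym (lookupVec-tabulate zero φ (w (i + j))))
                           (trans (sq j j<p) (lookupVec-tabulate zero φ (w (i + suc k + j))))

-- First-occurrence patterns

HasMinimalSubgraph : ∀ {n} → SimpleGraph n → Set
HasMinimalSubgraph G =
  HasSubgraph (C 3) G ⊎ HasSubgraph (C 4) G ⊎ HasSubgraph (C 5) G ⊎ HasSubgraph (P 5) G ⊎ HasSubgraph K13 G

P? : ∀ m (i j : Fin m) → Dec (P m i j)
P? m i j = (suc (toℕ i) ≟ toℕ j) ⊎-dec (suc (toℕ j) ≟ toℕ i)

C? : ∀ m (i j : Fin m) → Dec (C m i j)
C? m i j = P? m i j ⊎-dec (((toℕ i ≟ m ∸ 1) ×-dec (toℕ j ≟ 0)) ⊎-dec ((toℕ j ≟ m ∸ 1) ×-dec (toℕ i ≟ 0)))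

K13? : ∀ (i j : Fin 4) → Dec (K13 i j)
K13? i j = ((toℕ i ≟ 0) ×-dec ¬? (toℕ j ≟ 0)) ⊎-dec ((toℕ j ≟ 0) ×-dec ¬? (toℕ i ≟ 0))

anyList-applyUpTo : ∀ (Q : ℕ → Bool) f n x → x < n → T (Q (f x)) → T (anyList Q (applyUpTo f n))
anyList-applyUpTo Q f (suc n) zero _ q = ∨-introˡ q
anyList-applyUpTo Q f (suc n) (suc x) x<n q = ∨-introʳ {Q (f 0)} (anyList-applyUpTo Q (f ∘ suc) n x (≤-pred x<n) q)

anyList-filterᵇ : ∀ (P : ℕ → Bool) x l → T (P x) → T (anyList (x ≡ᵇ_) l) → T (anyList (x ≡ᵇ_) (filterᵇ P l))
anyList-filterᵇ P x (y ∷ l) px x∈l with P y in Py | ∨-elim {x ≡ᵇ y} x∈l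
... | true | inj₁ x≡y = ∨-introˡ x≡y
... | true | inj₂ x∈l′ = ∨-introʳ {x ≡ᵇ y} (anyList-filterᵇ P x l px x∈l′)
... | false | inj₁ x≡y = ⊥-elim (subst T Py (subst (T ∘ P) (≡ᵇ⇒≡ x y x≡y) px))
... | false | inj₂ x∈l′ = anyList-filterᵇ P x l px x∈l′

-- A walk is encoded by its first-occurrence pattern: each letter is replaced by the position where it
-- first occurs, so the labels of a pattern p are the positions s with p s = s, and the next letter is
-- either new (labelled by the current length) or an old label.
labels : List ℕ → List ℕ
labels p = filterᵇ (λ s → lookupList 0 p s ≡ᵇ s) (upTo (length p))

candidates : List ℕ → List ℕ
candidates p = length p ∷ labels p

edgeAtᵇ : List ℕ → ℕ → ℕ → ℕ → Bool
edgeAtᵇ p a b s = (suc s <ᵇ length p) ∧ (((lookupList 0 p s ≡ᵇ a) ∧ (lookupList 0 p (suc s) ≡ᵇ b)) ∨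
                                          ((lookupList 0 p s ≡ᵇ b) ∧ (lookupList 0 p (suc s) ≡ᵇ a)))

edgeᵇ : List ℕ → ℕ → ℕ → Bool
edgeᵇ p a b = anyBelow (length p) (edgeAtᵇ p a b)

record Target : Set₁ where
  field
    size : ℕ
    H : Fin size → Fin size → Set
    H? : ∀ i j → Dec (H i j)
    Hᵇ : ℕ → ℕ → Bool

firstJust : (ℕ → Maybe (List ℕ)) → List ℕ → Maybe (List ℕ)
firstJust f [] = nothing
firstJust f (c ∷ cs) with f c
... | just t = just t
... | nothing = firstJust f cs

-- Backtracking search for the images of 0, 1, … of a graph with edge test Hᵇ among the labels,
-- extending the partial assignment t; its answer is only trusted after verification.
embeddingSearch : (ℕ → ℕ → Bool) → List ℕ → (ℕ → ℕ → Bool) → List ℕ → ℕ → Maybe (List ℕ)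
embeddingSearch Hᵇ pool E t zero = just t
embeddingSearch Hᵇ pool E t (suc r) =
  firstJust (λ c → if fits c then embeddingSearch Hᵇ pool E (t ++ c ∷ []) r else nothing) pool
  where
  fits : ℕ → Bool
  fits c = not (anyList (λ x → x ≡ᵇ c) t) ∧ allBelow (length t) (λ j → not (Hᵇ j (length t)) ∨ E (lookupList 0 t j) c)

embeddingᵇ : (S : Target) → List ℕ → List ℕ → Bool
embeddingᵇ S t p = allFin (λ i → valid (image i)) ∧
                   (allFin (λ i → allFin (λ j → (i == j) ∨ not (image i ≡ᵇ image j))) ∧
                    allFin (λ i → allFin (λ j → not (isYes (Target.H? S i j)) ∨ edgeᵇ p (image i) (image j))))
  where
  image : Fin (Target.size S) → ℕ
  image i = lookupList 0 t (toℕ i)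
  valid : ℕ → Bool
  valid c = (c <ᵇ length p) ∧ (lookupList 0 p c ≡ᵇ c)

containsᵇ : Target → List ℕ → Bool
containsᵇ S p with embeddingSearch (Target.Hᵇ S) (labels p) (edgeᵇ p) [] (Target.size S)
... | just t = embeddingᵇ S t p
... | nothing = false

Pᵇ : ℕ → ℕ → Bool
Pᵇ i j = (suc i ≡ᵇ j) ∨ (suc j ≡ᵇ i)

Cᵇ : ℕ → ℕ → ℕ → Bool
Cᵇ m i j = Pᵇ i j ∨ ((i ≡ᵇ m ∸ 1) ∧ (j ≡ᵇ 0)) ∨ ((j ≡ᵇ m ∸ 1) ∧ (i ≡ᵇ 0))

K13ᵇ : ℕ → ℕ → Bool
K13ᵇ i j = ((i ≡ᵇ 0) ∧ not (j ≡ᵇ 0)) ∨ ((j ≡ᵇ 0) ∧ not (i ≡ᵇ 0))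

cycle : ℕ → Target
cycle m = record { size = m ; H = C m ; H? = C? m ; Hᵇ = Cᵇ m }

path₅ : Target
path₅ = record { size = 5 ; H = P 5 ; H? = P? 5 ; Hᵇ = Pᵇ }

claw : Target
claw = record { size = 4 ; H = K13 ; H? = K13? ; Hᵇ = K13ᵇ }

-- settled p d: every square-free walk pattern extending p, within d more letters, traverses one of
-- the five minimal graphs.
settled : List ℕ → ℕ → Bool
settled p zero = false
settled p (suc d) = squareSuffixᵇ (lookupList 0 p) (length p)
  ∨ (containsᵇ (cycle 3) p ∨ containsᵇ (cycle 4) p ∨ containsᵇ (cycle 5) p
     ∨ containsᵇ path₅ p ∨ containsᵇ claw p)
  ∨ allList (λ c → settled (p ++ c ∷ []) d) (candidates p)

firstBelow : (ℕ → Bool) → ℕ → ℕ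
firstBelow P zero = zero
firstBelow P (suc n) = if P 0 then 0 else suc (firstBelow (P ∘ suc) n)

firstBelow-≤ : ∀ P n → firstBelow P n ≤ n
firstBelow-≤ P zero = z≤n
firstBelow-≤ P (suc n) with P 0
... | true = z≤n
... | false = s≤s (firstBelow-≤ (P ∘ suc) n)

firstBelow-minimal : ∀ P n i → i < firstBelow P n → ¬ T (P i)
firstBelow-minimal P (suc n) i i< with P 0 in P0
firstBelow-minimal P (suc n) zero () | true
firstBelow-minimal P (suc n) (suc i) () | true
firstBelow-minimal P (suc n) zero _ | false = subst T P0
firstBelow-minimal P (suc n) (suc i) i< | false = firstBelow-minimal (P ∘ suc) n i (≤-pred i<)

firstBelow-found : ∀ P n → firstBelow P n < n → T (P (firstBelow P n))
firstBelow-found P (suc n) found with P 0 in P0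
... | true = subst T (sym P0) tt
... | false = firstBelow-found (P ∘ suc) n (≤-pred found)

module FirstOccurrences {n′} (G : SimpleGraph (suc n′)) (w : ℕ → Fin (suc n′))
                        (walk : IsWalk (Adj G) w) (squareFree : SquareFree w) where

  first : ℕ → ℕ
  first s = firstBelow (λ i → w i == w s) s

  w-first : ∀ s → w (first s) ≡ w s
  w-first s with m≤n⇒m<n∨m≡n (firstBelow-≤ (λ i → w i == w s) s)
  ... | inj₁ earlier = ==-sound (firstBelow-found (λ i → w i == w s) s earlier)
  ... | inj₂ itself = cong w itself

  first-cong : ∀ s s′ → w s ≡ w s′ → first s ≡ first s′
  first-cong s s′ same with <-cmp (first s) (first s′)
  ... | tri< below _ _ = ⊥-elim (firstBelow-minimal _ s′ (first s) below (==-complete (trans (w-first s) same)))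
  ... | tri≈ _ first≡ _ = first≡
  ... | tri> _ _ above = ⊥-elim (firstBelow-minimal _ s (first s′) above (==-complete (trans (w-first s′) (sym same))))

  first-idempotent : ∀ s → first (first s) ≡ first s
  first-idempotent s = first-cong (first s) s (w-first s)

  patternOf : ℕ → List ℕ
  patternOf M = applyUpTo first M

  patternOf-at : ∀ M s → s < M → lookupList 0 (patternOf M) s ≡ first s
  patternOf-at M = lookupList-applyUpTo 0 first M

  length-patternOf : ∀ M → length (patternOf M) ≡ M
  length-patternOf = length-applyUpTo first

  no-squareSuffix : ∀ M → ¬ T (squareSuffixᵇ (lookupList 0 (patternOf M)) (length (patternOf M)))
  no-squareSuffix M found =
    let (i , k , fits , sq) = squareSuffix-sound (lookupList 0 (patternOf M)) (length (patternOf M)) found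
        sq′ = square-prefix 0 (λ s → s) first M i k (subst (i + suc k + suc k ≤_) (length-patternOf M) fits) sq
    in squareFree i k λ j j<p → trans (sym (w-first (i + j))) (trans (cong w (sq′ j j<p)) (w-first (i + suc k + j)))

  labelled : ∀ M t {c} → t < M → T (lookupList 0 (patternOf M) t ≡ᵇ c) → w t ≡ w c
  labelled M t t<M e = trans (sym (w-first t)) (cong w (trans (sym (patternOf-at M t t<M)) (≡ᵇ⇒≡ _ _ e)))

  edgeᵇ-sound : ∀ M a b → T (edgeᵇ (patternOf M) a b) → Adj G (w a) (w b)
  edgeᵇ-sound M a b h with anyBelow-sound (length (patternOf M)) (edgeAtᵇ (patternOf M) a b) h
  ... | s , _ , at = orient (∨-elim (∧-elimʳ {suc s <ᵇ length (patternOf M)} at))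
    where
    p : List ℕ
    p = patternOf M
    s+1<M : suc s < M
    s+1<M = subst (suc s <_) (length-patternOf M) (<ᵇ⇒< _ _ (∧-elimˡ at))
    s<M : s < M
    s<M = <-trans (n<1+n s) s+1<M
    orient : T ((lookupList 0 p s ≡ᵇ a) ∧ (lookupList 0 p (suc s) ≡ᵇ b)) ⊎
             T ((lookupList 0 p s ≡ᵇ b) ∧ (lookupList 0 p (suc s) ≡ᵇ a)) → Adj G (w a) (w b)
    orient (inj₁ forward) =
      subst₂ (Adj G) (labelled M s s<M (∧-elimˡ forward))
                     (labelled M (suc s) s+1<M (∧-elimʳ {lookupList 0 p s ≡ᵇ a} forward)) (walk s)
    orient (inj₂ backward) = subst T (SimpleGraph.sym G (w b) (w a))
      (subst₂ (Adj G) (labelled M s s<M (∧-elimˡ backward))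
                      (labelled M (suc s) s+1<M (∧-elimʳ {lookupList 0 p s ≡ᵇ b} backward)) (walk s))

  embeddingᵇ-sound : ∀ M S t → T (embeddingᵇ S t (patternOf M)) → HasSubgraph (Target.H S) G
  embeddingᵇ-sound M S t cert = w ∘ image , injective , λ i j e → edgeᵇ-sound M (image i) (image j) (edge i j e)
    where
    open Target S
    p : List ℕ
    p = patternOf M
    image : Fin size → ℕ
    image i = lookupList 0 t (toℕ i)
    validᵇ distinctᵇ edgesᵇ : Bool
    validᵇ = allFin λ i → (image i <ᵇ length p) ∧ (lookupList 0 p (image i) ≡ᵇ image i)
    distinctᵇ = allFin λ i → allFin λ j → (i == j) ∨ not (image i ≡ᵇ image j)
    edgesᵇ = allFin λ i → allFin λ j → not (isYes (H? i j)) ∨ edgeᵇ p (image i) (image j)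
    isLabel : ∀ i → first (image i) ≡ image i
    isLabel i =
      let v = allFin-sound (λ i → (image i <ᵇ length p) ∧ (lookupList 0 p (image i) ≡ᵇ image i)) (∧-elimˡ cert) i
          inside = subst (image i <_) (length-patternOf M) (<ᵇ⇒< _ _ (∧-elimˡ v))
      in trans (sym (patternOf-at M (image i) inside)) (≡ᵇ⇒≡ _ _ (∧-elimʳ {image i <ᵇ length p} v))
    injective : ∀ {i j} → w (image i) ≡ w (image j) → i ≡ j
    injective {i} {j} same with ∨-elim (allFin-sound (λ j → (i == j) ∨ not (image i ≡ᵇ image j))
                              (allFin-sound (λ i → allFin λ j → (i == j) ∨ not (image i ≡ᵇ image j))
                                (∧-elimˡ (∧-elimʳ {validᵇ} cert)) i) j)
    ... | inj₁ i≡j = ==-sound i≡j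
    ... | inj₂ differ =
      ⊥-elim (not-elim differ (≡⇒≡ᵇ _ _ (trans (sym (isLabel i)) (trans (first-cong _ _ same) (isLabel j)))))
    edge : ∀ i j → H i j → T (edgeᵇ p (image i) (image j))
    edge i j e = modusPonens {isYes (H? i j)}
      (allFin-sound (λ j → not (isYes (H? i j)) ∨ edgeᵇ p (image i) (image j))
        (allFin-sound (λ i → allFin λ j → not (isYes (H? i j)) ∨ edgeᵇ p (image i) (image j))
          (∧-elimʳ {distinctᵇ} (∧-elimʳ {validᵇ} cert)) i) j)
      (fromWitness e)

  containsᵇ-sound : ∀ M S → T (containsᵇ S (patternOf M)) → HasSubgraph (Target.H S) G
  containsᵇ-sound M S h with embeddingSearch (Target.Hᵇ S) (labels (patternOf M)) (edgeᵇ (patternOf M)) [] (Target.size S)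
  ... | just t = embeddingᵇ-sound M S t h
  ... | nothing = ⊥-elim h

  next-is-candidate : ∀ M → T (anyList (first M ≡ᵇ_) (candidates (patternOf M)))
  next-is-candidate M with m≤n⇒m<n∨m≡n (firstBelow-≤ (λ i → w i == w M) M)
  ... | inj₂ new = ∨-introˡ (≡⇒≡ᵇ _ _ (trans new (sym (length-patternOf M))))
  ... | inj₁ old = ∨-introʳ {first M ≡ᵇ length (patternOf M)}
        (anyList-filterᵇ _ (first M) (upTo (length (patternOf M)))
          (≡⇒≡ᵇ _ _ (trans (patternOf-at M (first M) old) (first-idempotent M)))
          (anyList-applyUpTo (first M ≡ᵇ_) (λ s → s) (length (patternOf M)) (first M)
            (subst (first M <_) (sym (length-patternOf M)) old) (≡⇒≡ᵇ (first M) _ refl)))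

  settled-sound : ∀ d M → T (settled (patternOf M) d) → HasMinimalSubgraph G
  settled-sound (suc d) M h with ∨-elim {squareSuffixᵇ (lookupList 0 (patternOf M)) (length (patternOf M))} h
  ... | inj₁ square = ⊥-elim (no-squareSuffix M square)
  ... | inj₂ rest with ∨-elim rest
  ...   | inj₂ continue =
          let (c , settled-c , c≡next) = allList-anyList (λ c → settled (patternOf M ++ c ∷ []) d) (first M ≡ᵇ_)
                                           (candidates (patternOf M)) continue (next-is-candidate M)
          in settled-sound d (suc M)
               (subst (λ p → T (settled p d)) (trans (cong (patternOf M ∷ʳ_) (sym (≡ᵇ⇒≡ _ _ c≡next)))
                                                       (applyUpTo-∷ʳ first M)) settled-c)
  ...   | inj₁ found with ∨-elim found
  ...     | inj₁ c₃ = inj₁ (containsᵇ-sound M (cycle 3) c₃)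
  ...     | inj₂ found with ∨-elim found
  ...       | inj₁ c₄ = inj₂ (inj₁ (containsᵇ-sound M (cycle 4) c₄))
  ...       | inj₂ found with ∨-elim found
  ...         | inj₁ c₅ = inj₂ (inj₂ (inj₁ (containsᵇ-sound M (cycle 5) c₅)))
  ...         | inj₂ found with ∨-elim found
  ...           | inj₁ p₅ = inj₂ (inj₂ (inj₂ (inj₁ (containsᵇ-sound M path₅ p₅))))
  ...           | inj₂ k₁₃ = inj₂ (inj₂ (inj₂ (inj₂ (containsᵇ-sound M claw k₁₃))))

  settled-sound-initial : ∀ d → settled (0 ∷ []) d ≡ true → HasMinimalSubgraph G
  settled-sound-initial d search = settled-sound d 1 (Equivalence.from T-≡ search)

-- Square-free walks on the minimal graphs

pattern f0 = zero
pattern f1 = suc zero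
pattern f2 = suc (suc zero)
pattern f3 = suc (suc (suc zero))
pattern f4 = suc (suc (suc (suc zero)))

_≠_ : ∀ {n} → Fin n → Fin n → Bool
a ≠ b = not (a == b)

isWalk-isYes : ∀ {n} {R : Fin n → Fin n → Set} (R? : ∀ a b → Dec (R a b)) {w : ℕ → Fin n} →
  IsWalk (λ a b → T (isYes (R? a b))) w → IsWalk R w
isWalk-isYes R? walk j = toWitness (walk j)

-- Leech's square-free 13-uniform morphism.
leech : Fin 3 → Vec (Fin 3) 13
leech f0 = f0 ∷ f1 ∷ f2 ∷ f1 ∷ f0 ∷ f2 ∷ f1 ∷ f2 ∷ f0 ∷ f1 ∷ f2 ∷ f1 ∷ f0 ∷ []
leech f1 = f1 ∷ f2 ∷ f0 ∷ f2 ∷ f1 ∷ f0 ∷ f2 ∷ f0 ∷ f1 ∷ f2 ∷ f0 ∷ f2 ∷ f1 ∷ []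
leech f2 = f2 ∷ f0 ∷ f1 ∷ f0 ∷ f2 ∷ f1 ∷ f0 ∷ f1 ∷ f2 ∷ f0 ∷ f1 ∷ f0 ∷ f2 ∷ []

module Leech = FixedPoint 11 leech f0 refl

leechWord : ℕ → Fin 3
leechWord = Leech.fixedPoint

leechWord-isWalk : IsWalk (λ a b → T (a ≠ b)) leechWord
leechWord-isWalk = Leech.fixedPoint-isWalk _≠_ tt

leechWord-squareFree : SquareFree leechWord
leechWord-squareFree = Leech.fixedPoint-squareFree _≠_ 1 5 tt tt tt tt tt (≤ᵇ⇒≤ _ _ tt) λ ()

distinct⇒C₃ : ∀ a b → T (a ≠ b) → C 3 a b
distinct⇒C₃ f0 f0 ()
distinct⇒C₃ f1 f1 ()
distinct⇒C₃ f2 f2 ()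
distinct⇒C₃ f0 f1 _ = inj₁ (inj₁ refl)
distinct⇒C₃ f0 f2 _ = inj₂ (inj₂ (refl , refl))
distinct⇒C₃ f1 f0 _ = inj₁ (inj₂ refl)
distinct⇒C₃ f1 f2 _ = inj₁ (inj₁ refl)
distinct⇒C₃ f2 f0 _ = inj₂ (inj₁ (refl , refl))
distinct⇒C₃ f2 f1 _ = inj₁ (inj₂ refl)

c₄Image : Fin 3 → Vec (Fin 4) 8
c₄Image f0 = f0 ∷ f1 ∷ f0 ∷ f3 ∷ f0 ∷ f1 ∷ f2 ∷ f3 ∷ []
c₄Image f1 = f0 ∷ f1 ∷ f0 ∷ f3 ∷ f2 ∷ f1 ∷ f2 ∷ f3 ∷ []
c₄Image f2 = f0 ∷ f3 ∷ f2 ∷ f1 ∷ f0 ∷ f3 ∷ f2 ∷ f3 ∷ []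

module C₄Image = Uniform 7 c₄Image

c₄Word : ℕ → Fin 4
c₄Word = C₄Image.apply leechWord

c₄Word-isWalk : IsWalk (C 4) c₄Word
c₄Word-isWalk = isWalk-isYes (C? 4)
  (C₄Image.Walks.apply-isWalk _≠_ (λ a b → isYes (C? 4 a b)) tt leechWord leechWord-isWalk)

c₄Word-squareFree : SquareFree c₄Word
c₄Word-squareFree = C₄Image.Walks.Desubstitution.apply-squareFree _≠_ 1 5
  leechWord leechWord-isWalk tt tt tt tt (≤ᵇ⇒≤ _ _ tt) leechWord-squareFree

clawImage : Fin 3 → Vec (Fin 4) 2
clawImage a = f0 ∷ suc a ∷ []

module ClawImage = Uniform 1 clawImage

clawWord : ℕ → Fin 4
clawWord = ClawImage.apply leechWord

clawWord-isWalk : IsWalk K13 clawWord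
clawWord-isWalk = isWalk-isYes K13?
  (ClawImage.Walks.apply-isWalk _≠_ (λ a b → isYes (K13? a b)) tt leechWord leechWord-isWalk)

clawWord-squareFree : SquareFree clawWord
clawWord-squareFree = ClawImage.Walks.Desubstitution.apply-squareFree _≠_ 1 3
  leechWord leechWord-isWalk tt tt tt tt (≤ᵇ⇒≤ _ _ tt) leechWord-squareFree

-- The fixed point of τ is a square-free walk in the digraph τ-follows, which p₅Image maps into P₅.
τ : Fin 4 → Vec (Fin 4) 2
τ f0 = f2 ∷ f1 ∷ []
τ f1 = f1 ∷ f0 ∷ []
τ f2 = f2 ∷ f3 ∷ []
τ f3 = f1 ∷ f2 ∷ []

τ-follows : Fin 4 → Fin 4 → Bool
τ-follows f0 f2 = true
τ-follows f1 f0 = true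
τ-follows f1 f2 = true
τ-follows f2 f1 = true
τ-follows f2 f3 = true
τ-follows f3 f1 = true
τ-follows _ _ = false

module Tau = FixedPoint 0 τ f1 refl

τWord : ℕ → Fin 4
τWord = Tau.fixedPoint

τWord-isWalk : IsWalk (λ a b → T (τ-follows a b)) τWord
τWord-isWalk = Tau.fixedPoint-isWalk τ-follows tt

τWord-squareFree : SquareFree τWord
τWord-squareFree = Tau.fixedPoint-squareFree τ-follows 2 5 tt tt tt tt tt (≤ᵇ⇒≤ _ _ tt) λ ()

p₅Image : Fin 4 → Vec (Fin 5) 4
p₅Image f0 = f2 ∷ f3 ∷ f2 ∷ f1 ∷ []
p₅Image f1 = f2 ∷ f1 ∷ f0 ∷ f1 ∷ []
p₅Image f2 = f2 ∷ f3 ∷ f4 ∷ f3 ∷ []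
p₅Image f3 = f2 ∷ f1 ∷ f2 ∷ f3 ∷ []

p₅Colour : Fin 5 → Fin 3
p₅Colour f0 = f0
p₅Colour f1 = f1
p₅Colour f2 = f2
p₅Colour f3 = f0
p₅Colour f4 = f1

module P₅Image = Uniform 3 p₅Image
module P₅ColourImage = Uniform 3 (map p₅Colour ∘ p₅Image)

p₅Word : ℕ → Fin 5
p₅Word = P₅Image.apply τWord

p₅Word-isWalk : IsWalk (P 5) p₅Word
p₅Word-isWalk = isWalk-isYes (P? 5)
  (P₅Image.Walks.apply-isWalk τ-follows (λ a b → isYes (P? 5 a b)) tt τWord τWord-isWalk)

colouredP₅Word-squareFree : SquareFree (p₅Colour ∘ p₅Word)
colouredP₅Word-squareFree i k sq =
  P₅ColourImage.Walks.Desubstitution.apply-squareFree τ-follows 2 6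
    τWord τWord-isWalk tt tt tt tt (≤ᵇ⇒≤ _ _ tt) τWord-squareFree i k
    λ j j<p → trans (colour-apply (i + j)) (trans (sq j j<p) (sym (colour-apply (i + suc k + j))))
  where
  colour-apply : ∀ t → P₅ColourImage.apply τWord t ≡ p₅Colour (p₅Word t)
  colour-apply t = lookupVec-map p₅Colour zero (p₅Image (τWord (t / 4))) (t % 4)

p₅Word-squareFree : SquareFree p₅Word
p₅Word-squareFree = squareFree-map⁻ p₅Colour {p₅Word} colouredP₅Word-squareFree

leechWord-isWalk-C₃ : IsWalk (C 3) leechWord
leechWord-isWalk-C₃ j = distinct⇒C₃ _ _ (leechWord-isWalk j)

-- Embeddings and colourings

squareFreeWalk-embedding : ∀ {m n} (H : Fin m → Fin m → Set) (G : SimpleGraph n) → HasSubgraph H G →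
  ∀ v → IsWalk H v → SquareFree v → Σ (ℕ → Fin n) λ w → IsWalk (Adj G) w × SquareFree w
squareFreeWalk-embedding H G (f , injective , edges) v walk squareFree =
  f ∘ v , (λ j → edges _ _ (walk j)) , squareFree-map⁺ injective {v} squareFree

findFin : ∀ {m} → (Fin (suc m) → Bool) → Fin (suc m)
findFin {zero} P = zero
findFin {suc m} P = if P zero then zero else suc (findFin (P ∘ suc))

findFin-found : ∀ {m} (P : Fin (suc m) → Bool) i → T (P i) → T (P (findFin P))
findFin-found {zero} P zero h = h
findFin-found {suc m} P i h with P zero in P0
... | true = subst T (sym P0) tt
findFin-found {suc m} P zero h | false = ⊥-elim (subst T P0 h)
findFin-found {suc m} P (suc i) h | false = findFin-found (P ∘ suc) i h

leftInverse : ∀ {m n} → (Fin (suc m) → Fin n) → Fin n → Fin (suc m)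
leftInverse f u = findFin (λ i → f i == u)

leftInverse-injective : ∀ {m n} (f : Fin (suc m) → Fin n) → Injective _≡_ _≡_ f → ∀ i → leftInverse f (f i) ≡ i
leftInverse-injective f injective i = injective (==-sound (findFin-found (λ j → f j == f i) i (==-complete {a = f i} refl)))

colourable-embedding : ∀ {m n k} (H : Fin (suc m) → Fin (suc m) → Set) (G : SimpleGraph n) → HasSubgraph H G →
  ∀ v → IsWalk H v → (ψ : Fin (suc m) → Fin k) → SquareFree (ψ ∘ v) → Colourable (Adj G) k
colourable-embedding H G (f , injective , edges) v walk ψ squareFree =
  f ∘ v , (λ j → edges _ _ (walk j)) , ψ ∘ leftInverse f , λ i k sq →
    squareFree i k λ j j<p → trans (cong ψ (sym (leftInverse-injective f injective (v (i + j)))))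
                               (trans (sq j j<p) (cong ψ (leftInverse-injective f injective (v (i + suc k + j)))))

cycle₅⇒path₅ : ∀ {n} (G : SimpleGraph n) → HasSubgraph (C 5) G → HasSubgraph (P 5) G
cycle₅⇒path₅ G (f , injective , edges) = f , injective , λ i j e → edges i j (inj₁ e)

path-restrict : ∀ {n m} (G : SimpleGraph n) → 5 ≤ m → HasSubgraph (P m) G → HasSubgraph (P 5) G
path-restrict {m = m} G 5≤m (f , injective , edges) =
  f ∘ embed ,
  (λ {i} {j} e → Fin.toℕ-injective (trans (sym (toℕ-embed i)) (trans (cong toℕ (injective e)) (toℕ-embed j)))) ,
  λ i j e → edges (embed i) (embed j) (preserve i j e)
  where
  embed : Fin 5 → Fin m
  embed i = inject≤ i 5≤m
  toℕ-embed : ∀ i → toℕ (embed i) ≡ toℕ i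
  toℕ-embed i = Fin.toℕ-inject≤ i 5≤m
  preserve : ∀ i j → P 5 i j → P m (embed i) (embed j)
  preserve i j (inj₁ e) = inj₁ (trans (cong suc (toℕ-embed i)) (trans e (sym (toℕ-embed j))))
  preserve i j (inj₂ e) = inj₂ (trans (cong suc (toℕ-embed j)) (trans e (sym (toℕ-embed i))))

binary-square : (u : ℕ → Fin 2) → Σ ℕ λ i → Σ ℕ λ k → Square u i k
binary-square u =
  let (i , k , fits , sq) = squareWithin-sound (lookupVec zero (window u 0 4)) 4
                              (allVec-sound 4 (λ v → squareWithin (lookupVec zero v) 4) tt (window u 0 4))
  in i , k , square-in-window zero u 0 4 i k fits sq

fewLetters-square : ∀ {k} (u : ℕ → Fin k) → k ≤ 2 → ¬ SquareFree u
fewLetters-square {zero} u _ _ with u 0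
... | ()
fewLetters-square {suc zero} u _ squareFree = squareFree 0 0 λ { zero _ → single (u 0) (u 1) ; (suc j) (s≤s ()) }
  where
  single : (a b : Fin 1) → a ≡ b
  single zero zero = refl
fewLetters-square {suc (suc zero)} u _ squareFree = let (i , k , sq) = binary-square u in squareFree i k sq
fewLetters-square {suc (suc (suc _))} u (s≤s (s≤s ()))

not-colourable-by-two : ∀ {n} (R : Fin n → Fin n → Set) k → k ≤ 2 → ¬ Colourable R k
not-colourable-by-two R k k≤2 (w , _ , φ , squareFree) = fewLetters-square (φ ∘ w) k≤2 squareFree

neighbours-complete : ∀ {m} (neighbours : Fin (suc m) → List (Fin (suc m))) {R : Fin (suc m) → Fin (suc m) → Set}
  (R? : ∀ a b → Dec (R a b)) → T (allFin λ a → allFin λ b → not (isYes (R? a b)) ∨ anyList (_== b) (neighbours a)) →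
  ∀ {w} → IsWalk R w → NeighbourWalk neighbours w
neighbours-complete neighbours R? cert {w} walk j = modusPonens {isYes (R? (w j) (w (suc j)))}
  (allFin-sound (listed (w j)) (allFin-sound (λ a → allFin (listed a)) cert (w j)) (w (suc j)))
  (fromWitness (walk j))
  where
  listed : Fin (suc _) → Fin (suc _) → Bool
  listed a b = not (isYes (R? a b)) ∨ anyList (_== b) (neighbours a)

not-colourable-by-three : ∀ {m} {R : Fin (suc m) → Fin (suc m) → Set} (neighbours : Fin (suc m) → List (Fin (suc m)))
  (R? : ∀ a b → Dec (R a b)) → T (allFin λ a → allFin λ b → not (isYes (R? a b)) ∨ anyList (_== b) (neighbours a)) →
  ∀ d → T (ColouringSearch.allDoomedᵇ {k′ = 2} neighbours d) → ¬ Colourable R 3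
not-colourable-by-three neighbours R? listed d doomed (w , walk , φ , squareFree) =
  let (i , k , sq) = ColouringSearch.no-squareFree-colouring neighbours d doomed w
                       (neighbours-complete neighbours R? listed walk) φ
  in squareFree i k sq

c₄Neighbours : Fin 4 → List (Fin 4)
c₄Neighbours f0 = f1 ∷ f3 ∷ []
c₄Neighbours f1 = f0 ∷ f2 ∷ []
c₄Neighbours f2 = f1 ∷ f3 ∷ []
c₄Neighbours f3 = f0 ∷ f2 ∷ []

clawNeighbours : Fin 4 → List (Fin 4)
clawNeighbours f0 = f1 ∷ f2 ∷ f3 ∷ []
clawNeighbours _ = f0 ∷ []

c₄-not-colourable-by-three : ¬ Colourable (C 4) 3
c₄-not-colourable-by-three = not-colourable-by-three c₄Neighbours (C? 4) tt 17 tt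

claw-not-colourable-by-three : ¬ Colourable K13 3
claw-not-colourable-by-three = not-colourable-by-three clawNeighbours K13? tt 9 tt

-- Stated as an equation so that the search is evaluated once by conversion; checking tt against
-- T (settled …) is much slower.
walkPatterns-settled : settled (0 ∷ []) 17 ≡ true
walkPatterns-settled = refl

squareFreeWalk⇒minimal : ∀ {n} (G : SimpleGraph n) →
  Σ (ℕ → Fin n) (λ w → IsWalk (Adj G) w × SquareFree w) → HasMinimalSubgraph G
squareFreeWalk⇒minimal {zero} G (w , _) with w 0
... | ()
squareFreeWalk⇒minimal {suc n} G (w , walk , squareFree) =
  FirstOccurrences.settled-sound-initial G w walk squareFree 17 walkPatterns-settled

minimal⇒squareFreeWalk : ∀ {n} (G : SimpleGraph n) →
  HasMinimalSubgraph G → Σ (ℕ → Fin n) λ w → IsWalk (Adj G) w × SquareFree w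
minimal⇒squareFreeWalk G (inj₁ c₃) =
  squareFreeWalk-embedding (C 3) G c₃ leechWord leechWord-isWalk-C₃ leechWord-squareFree
minimal⇒squareFreeWalk G (inj₂ (inj₁ c₄)) =
  squareFreeWalk-embedding (C 4) G c₄ c₄Word c₄Word-isWalk c₄Word-squareFree
minimal⇒squareFreeWalk G (inj₂ (inj₂ (inj₁ c₅))) =
  squareFreeWalk-embedding (P 5) G (cycle₅⇒path₅ G c₅) p₅Word p₅Word-isWalk p₅Word-squareFree
minimal⇒squareFreeWalk G (inj₂ (inj₂ (inj₂ (inj₁ p₅)))) =
  squareFreeWalk-embedding (P 5) G p₅ p₅Word p₅Word-isWalk p₅Word-squareFree
minimal⇒squareFreeWalk G (inj₂ (inj₂ (inj₂ (inj₂ k₁₃)))) =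
  squareFreeWalk-embedding K13 G k₁₃ clawWord clawWord-isWalk clawWord-squareFree

γ≡3 : ∀ {n} (R : Fin n → Fin n → Set) → Colourable R 3 → γ≡ R 3
γ≡3 R colourable = colourable , λ k k<3 → not-colourable-by-two R k (≤-pred k<3)

γ≡4 : ∀ {n} (R : Fin n → Fin n → Set) → Colourable R 4 → ¬ Colourable R 3 → γ≡ R 4
γ≡4 R colourable ¬three = colourable , below
  where
  below : ∀ k → k < 4 → ¬ Colourable R k
  below k k<4 with m≤n⇒m<n∨m≡n (≤-pred k<4)
  ... | inj₁ k<3 = not-colourable-by-two R k (≤-pred k<3)
  ... | inj₂ refl = ¬three

colourable-by-three : ∀ {n} (G : SimpleGraph n) →
  HasSubgraph (C 3) G ⊎ Σ ℕ (λ m → 5 ≤ m × HasSubgraph (P m) G) → Colourable (Adj G) 3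
colourable-by-three G (inj₁ c₃) =
  colourable-embedding (C 3) G c₃ leechWord leechWord-isWalk-C₃ id leechWord-squareFree
colourable-by-three G (inj₂ (m , 5≤m , pₘ)) =
  colourable-embedding (P 5) G (path-restrict G 5≤m pₘ) p₅Word p₅Word-isWalk p₅Colour colouredP₅Word-squareFree

theorem1 : ((n : ℕ) (G : SimpleGraph n) →
      (Σ (ℕ → Fin n) λ w → IsWalk (Adj G) w × SquareFree w)
        ⇔ (HasSubgraph (C 3) G ⊎ HasSubgraph (C 4) G ⊎ HasSubgraph (C 5) G
            ⊎ HasSubgraph (P 5) G ⊎ HasSubgraph K13 G))
    × ((n : ℕ) (G : SimpleGraph n) →
        (HasSubgraph (C 3) G ⊎ Σ ℕ (λ m → 5 ≤ m × HasSubgraph (P m) G)) →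
        γ≡ (Adj G) 3)
    × γ≡ (C 4) 4
    × γ≡ K13 4
theorem1 =
    (λ n G → mk⇔ (squareFreeWalk⇒minimal G) (minimal⇒squareFreeWalk G))
  , (λ n G → γ≡3 (Adj G) ∘ colourable-by-three G)
  , γ≡4 (C 4) (c₄Word , c₄Word-isWalk , id , c₄Word-squareFree) c₄-not-colourable-by-three
  , γ≡4 K13 (clawWord , clawWord-isWalk , id , clawWord-squareFree) claw-not-colourable-by-three
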